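{- For every optimal solution of an instance of MinAvgSTC in which all jobs have unit weight ($w_j=1$), with $K$ scenarios and any number $m$ of machines, the final disbalance under each scenario satisfies $d_k\le \sqrt{K}\cdot 2^{K-1}$ for all $k\in[K]$.
   Context: An instance consists of jobs $[n]$, machines $[m]$, scenarios $S_1,\dots,S_K\subseteq[n]$ and weights $w_j$ (here all equal to $1$). A solution is an assignment $\varphi:[n]\to[m]$; write $J_i=\varphi^{ -1}(i)$. With unit weights, the cost of $\varphi$ in scenario $k$ is $G(\varphi,k)=\sum_{i=1}^m \tfrac12|J_i\cap S_k|(|J_i\cap S_k|+1)$. MinAvgSTC asks to minimize $\sum_{k=1}^K G(\varphi,k)$. The final disbalance under scenario $k$ is $d_k=\max_{i\in[m]}|J_i\cap S_k|-\min_{i\in[m]}|J_i\cap S_k|$. -}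

module Defs where

open import Data.Nat using (ℕ; zero; suc; _+_; _*_; _∸_; _⊔_; _⊓_; _≤_; _^_)
open import Data.Fin using (Fin; zero; suc; _≟_)
open import Data.Fin.Subset using (Subset; _∩_; ∣_∣)
open import Data.Vec using (tabulate)
open import Relation.Nullary.Decidable using (⌊_⌋)

sumF : ∀ {m} → (Fin m → ℕ) → ℕ
sumF {zero}  f = 0
sumF {suc m} f = f zero + sumF (λ i → f (suc i))

-- max / min over a finite nonempty index set (value 0 on the empty index set,
-- which only arises for m = 0, where necessarily n = 0)
maxF : ∀ {m} → (Fin m → ℕ) → ℕ
maxF {zero}  f = 0
maxF {suc zero} f = f zero
maxF {suc (suc m)} f = f zero ⊔ maxF (λ i → f (suc i))

minF : ∀ {m} → (Fin m → ℕ) → ℕ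
minF {zero}  f = 0
minF {suc zero} f = f zero
minF {suc (suc m)} f = f zero ⊓ minF (λ i → f (suc i))

-- triangular number: tri c = c (c + 1) / 2
tri : ℕ → ℕ
tri zero = 0
tri (suc c) = suc c + tri c

-- An instance with unit weights: n jobs, m machines, K scenarios S k ⊆ [n].
Scenarios : ℕ → ℕ → Set
Scenarios n K = Fin K → Subset n

Assignment : ℕ → ℕ → Set
Assignment n m = Fin n → Fin m

J : ∀ {n m} → Assignment n m → Fin m → Subset n
J φ i = tabulate (λ j → ⌊ φ j ≟ i ⌋)

load : ∀ {n m K} → Scenarios n K → Assignment n m → Fin K → Fin m → ℕ
load S φ k i = ∣ J φ i ∩ S k ∣

G : ∀ {n m K} → Scenarios n K → Assignment n m → Fin K → ℕ
G S φ k = sumF (λ i → tri (load S φ k i))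

cost : ∀ {n m K} → Scenarios n K → Assignment n m → ℕ
cost S φ = sumF (λ k → G S φ k)

Optimal : ∀ {n m K} → Scenarios n K → Assignment n m → Set
Optimal {n} {m} S φ = (ψ : Assignment n m) → cost S φ ≤ cost S ψ

disbalance : ∀ {n m K} → Scenarios n K → Assignment n m → Fin K → ℕ
disbalance S φ k = maxF (load S φ k) ∸ minF (load S φ k)

-- Let a and b be machines of maximal and minimal load in scenario k and redistribute their
-- jobs between them according to a 2-colouring. This leaves the other machines and, in every
-- scenario, the sum x + y of the two loads unchanged; since 4 (T x + T y) =
-- (x + y)² + 2 (x + y) + (x − y)² for triangular numbers T, optimality forces
-- Σ_k (x_k − y_k)² to be at most its value after any such redistribution. Colouring the jobs
-- recursively, one scenario at a time, makes the imbalance at most 2^(K−1) in every scenario,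
-- so d_k² ≤ Σ_k (x_k − y_k)² ≤ K · (2^(K−1))².
module Submission where

open import Data.Bool using (Bool; true; false; not; _∧_; _∨_; if_then_else_)
open import Data.Bool.Properties using (∧-assoc; ∧-comm; ∧-zeroʳ; ∧-inverseʳ; ∧-idem; if-float)
open import Data.Fin using (Fin; zero; suc; _≟_)
open import Data.Fin.Properties using (suc-injective)
open import Data.Fin.Subset using (Subset; _∩_; ∣_∣)
open import Data.Nat using (ℕ; zero; suc; _+_; _*_; _∸_; _^_; _≤_; z≤n; s≤s; _≤?_; _⊔_; _⊓_; ∣_-_∣)
open import Data.Nat.Properties hiding (_≟_; suc-injective)
open import Data.Nat.Tactic.RingSolver using (solve-∀)
open import Algebra.Properties.CommutativeSemigroup +-commutativeSemigroup
  using (interchange; xy∙z≈xz∙y; xy∙z≈zy∙x; xy∙z≈x∙zy)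
open import Data.Product using (∃-syntax; _×_; _,_)
open import Data.Sum using (inj₁; inj₂)
open import Data.Vec using ([]; _∷_; tabulate; lookup)
open import Function using (_∘_)
open import Relation.Binary.PropositionalEquality
open import Relation.Nullary using (yes; no; contradiction)
open import Relation.Nullary.Decidable using (⌊_⌋; isYes≗does; dec-true; dec-false)

open import Defs

sumF-cong : ∀ {m} {f g : Fin m → ℕ} → (∀ i → f i ≡ g i) → sumF f ≡ sumF g
sumF-cong {zero}  f≗g = refl
sumF-cong {suc m} f≗g = cong₂ _+_ (f≗g zero) (sumF-cong (λ i → f≗g (suc i)))

sumF-+ : ∀ {m} (f g : Fin m → ℕ) → sumF (λ i → f i + g i) ≡ sumF f + sumF g
sumF-+ {zero}  f g = refl
sumF-+ {suc m} f g = begin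
  (f zero + g zero) + sumF (λ i → f (suc i) + g (suc i))
    ≡⟨ cong (f zero + g zero +_) (sumF-+ (f ∘ suc) (g ∘ suc)) ⟩
  (f zero + g zero) + (sumF (f ∘ suc) + sumF (g ∘ suc))
    ≡⟨ interchange (f zero) (g zero) _ _ ⟩
  sumF f + sumF g ∎
  where open ≡-Reasoning

*-distribˡ-sumF : ∀ {m} c (f : Fin m → ℕ) → c * sumF f ≡ sumF (λ i → c * f i)
*-distribˡ-sumF {zero}  c f = *-zeroʳ c
*-distribˡ-sumF {suc m} c f =
  trans (*-distribˡ-+ c (f zero) _) (cong (c * f zero +_) (*-distribˡ-sumF c (f ∘ suc)))

sumF-mono-≤ : ∀ {m} {f g : Fin m → ℕ} → (∀ i → f i ≤ g i) → sumF f ≤ sumF g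
sumF-mono-≤ {zero}  f≤g = z≤n
sumF-mono-≤ {suc m} f≤g = +-mono-≤ (f≤g zero) (sumF-mono-≤ (λ i → f≤g (suc i)))

sumF-const : ∀ m c → sumF {m} (λ _ → c) ≡ m * c
sumF-const zero    c = refl
sumF-const (suc m) c = cong (c +_) (sumF-const m c)

f≤sumF : ∀ {m} (f : Fin m → ℕ) i → f i ≤ sumF f
f≤sumF f zero    = m≤m+n _ _
f≤sumF f (suc i) = ≤-trans (f≤sumF (f ∘ suc) i) (m≤n+m _ _)

sumF-swap₁ : ∀ {m} (a : Fin m) {f g : Fin m → ℕ} → (∀ i → i ≢ a → f i ≡ g i) →
             sumF f + g a ≡ sumF g + f a
sumF-swap₁ zero {f} {g} f≗g = begin
  (f zero + sumF (f ∘ suc)) + g zero ≡⟨ cong (λ t → (f zero + t) + g zero) (sumF-cong (λ i → f≗g (suc i) λ ())) ⟩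
  (f zero + sumF (g ∘ suc)) + g zero ≡⟨ xy∙z≈zy∙x (f zero) _ (g zero) ⟩
  (g zero + sumF (g ∘ suc)) + f zero ∎
  where open ≡-Reasoning
sumF-swap₁ (suc a) {f} {g} f≗g = begin
  (f zero + sumF (f ∘ suc)) + g (suc a) ≡⟨ +-assoc (f zero) _ _ ⟩
  f zero + (sumF (f ∘ suc) + g (suc a))
    ≡⟨ cong₂ _+_ (f≗g zero λ ()) (sumF-swap₁ a (λ i i≢a → f≗g (suc i) (i≢a ∘ suc-injective))) ⟩
  g zero + (sumF (g ∘ suc) + f (suc a)) ≡⟨ +-assoc (g zero) _ _ ⟨
  (g zero + sumF (g ∘ suc)) + f (suc a) ∎
  where open ≡-Reasoning

⌊x≟x⌋ : ∀ {m} (x : Fin m) → ⌊ x ≟ x ⌋ ≡ true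
⌊x≟x⌋ x = trans (isYes≗does (x ≟ x)) (dec-true (x ≟ x) refl)

⌊x≟y⌋ : ∀ {m} {x y : Fin m} → x ≢ y → ⌊ x ≟ y ⌋ ≡ false
⌊x≟y⌋ {x = x} {y} x≢y = trans (isYes≗does (x ≟ y)) (dec-false (x ≟ y) x≢y)

sumF-swap₂ : ∀ {m} {a b : Fin m} → a ≢ b → {f g : Fin m → ℕ} → (∀ i → i ≢ a → i ≢ b → f i ≡ g i) →
             sumF f + (g a + g b) ≡ sumF g + (f a + f b)
sumF-swap₂ {m} {a} {b} a≢b {f} {g} f≗g = begin
  sumF f + (g a + g b) ≡⟨ +-assoc (sumF f) (g a) (g b) ⟨
  (sumF f + g a) + g b ≡⟨ cong (λ t → (sumF f + t) + g b) (h≗g a a≢b) ⟨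
  (sumF f + h a) + g b ≡⟨ cong (_+ g b) (sumF-swap₁ a h≗f) ⟨
  (sumF h + f a) + g b ≡⟨ xy∙z≈xz∙y (sumF h) (f a) (g b) ⟩
  (sumF h + g b) + f a ≡⟨ cong (_+ f a) (sumF-swap₁ b (λ i i≢b → sym (h≗g i i≢b))) ⟨
  (sumF g + h b) + f a ≡⟨ cong (λ t → (sumF g + t) + f a) hb≡fb ⟩
  (sumF g + f b) + f a ≡⟨ xy∙z≈x∙zy (sumF g) (f b) (f a) ⟩
  sumF g + (f a + f b) ∎
  where
  open ≡-Reasoning
  h : Fin m → ℕ
  h i = if ⌊ i ≟ b ⌋ then f i else g i
  h≗g : ∀ i → i ≢ b → h i ≡ g i
  h≗g i i≢b = cong (if_then f i else g i) (⌊x≟y⌋ i≢b)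
  hb≡fb : h b ≡ f b
  hb≡fb = cong (if_then f b else g b) (⌊x≟x⌋ b)
  h≗f : ∀ i → i ≢ a → h i ≡ f i
  h≗f i i≢a with i ≟ b
  ... | yes _  = refl
  ... | no i≢b = sym (f≗g i i≢a i≢b)

count : ∀ {n} → (Fin n → Bool) → ℕ
count q = sumF (λ j → if q j then 1 else 0)

count-cong : ∀ {n} {q q′ : Fin n → Bool} → (∀ j → q j ≡ q′ j) → count q ≡ count q′
count-cong q≗q′ = sumF-cong (λ j → cong (if_then 1 else 0) (q≗q′ j))

∣tabulate∩∣≡count : ∀ {n} (g : Fin n → Bool) (s : Subset n) →
                    ∣ tabulate g ∩ s ∣ ≡ count (λ j → g j ∧ lookup s j)
∣tabulate∩∣≡count g []      = refl
∣tabulate∩∣≡count g (x ∷ s) with g zero | x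
... | false | _     = ∣tabulate∩∣≡count (g ∘ suc) s
... | true  | false = ∣tabulate∩∣≡count (g ∘ suc) s
... | true  | true  = cong suc (∣tabulate∩∣≡count (g ∘ suc) s)

_∧̇_ : ∀ {n} → (Fin n → Bool) → (Fin n → Bool) → Fin n → Bool
(p ∧̇ q) j = p j ∧ q j

red blue : ∀ {n} → (Fin n → Bool) → (Fin n → Bool) → ℕ
red  q c = count (q ∧̇ c)
blue q c = count (q ∧̇ (not ∘ c))

count≡red+blue : ∀ {n} (q c : Fin n → Bool) → count q ≡ red q c + blue q c
count≡red+blue {n} q c = trans (sumF-cong (λ j → split (q j) (c j))) (sumF-+ {n} _ _)
  where
  split : ∀ x y → (if x then 1 else 0) ≡ (if x ∧ y then 1 else 0) + (if x ∧ not y then 1 else 0)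
  split false _     = refl
  split true  false = refl
  split true  true  = refl

count-∨ : ∀ {n} (u v s : Fin n → Bool) → (∀ j → u j ∧ v j ≡ false) →
          count (u ∧̇ s) + count (v ∧̇ s) ≡ count ((λ j → u j ∨ v j) ∧̇ s)
count-∨ {n} u v s disjoint = trans (sym (sumF-+ {n} _ _)) (sumF-cong (λ j → merge (u j) (v j) (s j) (disjoint j)))
  where
  merge : ∀ x y z → x ∧ y ≡ false →
          (if x ∧ z then 1 else 0) + (if y ∧ z then 1 else 0) ≡ (if (x ∨ y) ∧ z then 1 else 0)
  merge true  true  z ()
  merge true  false z _ = +-identityʳ _
  merge false y     z _ = refl

red-if : ∀ {n} (q g c₁ c₀ : Fin n → Bool) →
         red q (λ j → if g j then c₁ j else c₀ j) ≡ red (q ∧̇ (not ∘ g)) c₀ + red (q ∧̇ g) c₁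
red-if {n} q g c₁ c₀ = trans (sumF-cong (λ j → split (q j) (g j))) (sumF-+ {n} _ _)
  where
  split : ∀ x y {z₁ z₀} → (if x ∧ (if y then z₁ else z₀) then 1 else 0) ≡
                          (if (x ∧ not y) ∧ z₀ then 1 else 0) + (if (x ∧ y) ∧ z₁ then 1 else 0)
  split false _     = refl
  split true  false = sym (+-identityʳ _)
  split true  true  = refl

blue-if : ∀ {n} (q g c₁ c₀ : Fin n → Bool) →
          blue q (λ j → if g j then c₁ j else c₀ j) ≡ blue (q ∧̇ (not ∘ g)) c₀ + blue (q ∧̇ g) c₁
blue-if q g c₁ c₀ =
  trans (count-cong (λ j → cong (q j ∧_) (if-float not (g j)))) (red-if q g (not ∘ c₁) (not ∘ c₀))

-- ∣ a - b ∣ ≤ M, in a form that adds up without truncated subtraction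
Near : ℕ → ℕ → ℕ → Set
Near M a b = a ≤ b + M × b ≤ a + M

Near-refl : ∀ {M a} → Near M a a
Near-refl = m≤m+n _ _ , m≤m+n _ _

Near-+ : ∀ {M₀ M₁ a₀ a₁ b₀ b₁} → Near M₀ a₀ b₀ → Near M₁ a₁ b₁ →
         Near (M₀ + M₁) (a₀ + a₁) (b₀ + b₁)
Near-+ {M₀} {M₁} {a₀} {a₁} {b₀} {b₁} (a₀≤ , b₀≤) (a₁≤ , b₁≤) =
  ≤-trans (+-mono-≤ a₀≤ a₁≤) (≤-reflexive (interchange b₀ M₀ b₁ M₁)) ,
  ≤-trans (+-mono-≤ b₀≤ b₁≤) (≤-reflexive (interchange a₀ M₀ a₁ M₁))

Near⇒∣-∣≤ : ∀ {M a b} → Near M a b → ∣ a - b ∣ ≤ M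
Near⇒∣-∣≤ {M} {a} {b} (a≤ , b≤) with ≤-total a b
... | inj₁ a≤b = subst (_≤ M) (sym (m≤n⇒∣m-n∣≡n∸m a≤b)) (m≤n+o⇒m∸n≤o b a b≤)
... | inj₂ b≤a = subst (_≤ M) (sym (m≤n⇒∣n-m∣≡n∸m b≤a)) (m≤n+o⇒m∸n≤o a b a≤)

record Balanced {n} (M : ℕ) (c q : Fin n → Bool) : Set where
  constructor balanced
  field near : Near M (red q c) (blue q c)

Balanced-cong : ∀ {n M} {c q q′ : Fin n → Bool} → (∀ j → q j ≡ q′ j) → Balanced M c q → Balanced M c q′
Balanced-cong {c = c} q≗q′ (balanced near) = balanced
  (subst₂ (Near _) (count-cong (λ j → cong (_∧ c j) (q≗q′ j)))
                   (count-cong (λ j → cong (_∧ not (c j)) (q≗q′ j))) near)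

Balanced-empty : ∀ {n M} {c q : Fin n → Bool} → (∀ j → q j ≡ false) → Balanced M c q
Balanced-empty {c = c} q≗false = balanced
  (subst (Near _ _) (trans (count-cong (λ j → cong (_∧ c j) (q≗false j)))
                           (sym (count-cong (λ j → cong (_∧ not (c j)) (q≗false j))))) Near-refl)

Balanced-if : ∀ {n M₀ M₁} {q g c₁ c₀ : Fin n → Bool} →
              Balanced M₀ c₀ (q ∧̇ (not ∘ g)) → Balanced M₁ c₁ (q ∧̇ g) →
              Balanced (M₀ + M₁) (λ j → if g j then c₁ j else c₀ j) q
Balanced-if {q = q} {g} {c₁} {c₀} (balanced near₀) (balanced near₁) = balanced
  (subst₂ (Near _) (sym (red-if q g c₁ c₀)) (sym (blue-if q g c₁ c₀)) (Near-+ near₀ near₁))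

Near-1-insert : ∀ x {r b} → Near 1 r b →
                ∃[ y ] Near 1 ((if x ∧ y then 1 else 0) + r) ((if x ∧ not y then 1 else 0) + b)
Near-1-insert false near = false , near
Near-1-insert true {r} {b} (r≤b+1 , b≤r+1) with r ≤? b
... | yes r≤b = true , ≤-trans (s≤s r≤b) (≤-reflexive (+-comm 1 b)) , ≤-trans b≤r+1 (+-monoˡ-≤ 1 (n≤1+n r))
... | no r≰b  = false , ≤-trans r≤b+1 (+-monoˡ-≤ 1 (n≤1+n b)) , ≤-trans (≰⇒> r≰b) (m≤m+n r 1)

halvingColouring : ∀ {n} (p : Fin n → Bool) → ∃[ c ] Balanced 1 c p
halvingColouring {zero}  p = (λ ()) , balanced (z≤n , z≤n)
halvingColouring {suc n} p
  with c , balanced near ← halvingColouring (p ∘ suc)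
  with y , near′ ← Near-1-insert (p zero) near
  = (λ { zero → y ; (suc j) → c j }) , balanced near′

2^n+2^n≡2^[1+n] : ∀ n → 2 ^ n + 2 ^ n ≡ 2 ^ suc n
2^n+2^n≡2^[1+n] n = cong (2 ^ n +_) (sym (+-identityʳ (2 ^ n)))

xy∧z≡xz∧y : ∀ x y z → (x ∧ y) ∧ z ≡ (x ∧ z) ∧ y
xy∧z≡xz∧y false y z = refl
xy∧z≡xz∧y true  y z = ∧-comm y z

-- The total is bounded too because on scenario zero the colouring is that of p ∧̇ f zero as a whole.
balancedColouring : ∀ {n} K (f : Fin K → Fin n → Bool) (p : Fin n → Bool) →
                    ∃[ c ] Balanced (2 ^ K) c p × (∀ k → Balanced (2 ^ (K ∸ 1)) c (p ∧̇ f k))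
balancedColouring zero f p with c , bal ← halvingColouring p = c , bal , λ ()
balancedColouring {n} (suc K) f p
  with c₀ , total₀ , bal₀ ← balancedColouring K (f ∘ suc) (p ∧̇ (not ∘ f zero))
     | c₁ , total₁ , bal₁ ← balancedColouring K (f ∘ suc) (p ∧̇ f zero)
  = c , total , bal
  where
  g : Fin n → Bool
  g = f zero
  c : Fin n → Bool
  c j = if g j then c₁ j else c₀ j
  total : Balanced (2 ^ suc K) c p
  total = subst (λ M → Balanced M c p) (2^n+2^n≡2^[1+n] K) (Balanced-if total₀ total₁)
  bal : ∀ k → Balanced (2 ^ K) c (p ∧̇ f k)
  bal zero    = Balanced-if (Balanced-empty λ j → outside (p j) (g j))
                            (Balanced-cong (λ j → inside (p j) (g j)) total₁)
    where
    inside : ∀ x y → x ∧ y ≡ (x ∧ y) ∧ y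
    inside x y = sym (trans (∧-assoc x y y) (cong (x ∧_) (∧-idem y)))
    outside : ∀ x y → (x ∧ y) ∧ not y ≡ false
    outside x y = trans (∧-assoc x y (not y)) (trans (cong (x ∧_) (∧-inverseʳ y)) (∧-zeroʳ x))
  bal (suc k) = subst (λ M → Balanced M c (p ∧̇ f (suc k))) (doubling k)
                  (Balanced-if (Balanced-cong (λ j → xy∧z≡xz∧y (p j) (not (g j)) (f (suc k) j)) (bal₀ k))
                               (Balanced-cong (λ j → xy∧z≡xz∧y (p j) (g j) (f (suc k) j)) (bal₁ k)))
    where
    doubling : ∀ {K} → Fin K → 2 ^ (K ∸ 1) + 2 ^ (K ∸ 1) ≡ 2 ^ K
    doubling {suc K} _ = 2^n+2^n≡2^[1+n] K

infix 8 _²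
_² : ℕ → ℕ
x ² = x * x

2*tri≡²+ : ∀ x → 2 * tri x ≡ x ² + x
2*tri≡²+ zero    = refl
2*tri≡²+ (suc x) = begin
  2 * (suc x + tri x)        ≡⟨ *-distribˡ-+ 2 (suc x) (tri x) ⟩
  2 * suc x + 2 * tri x      ≡⟨ cong (2 * suc x +_) (2*tri≡²+ x) ⟩
  2 * suc x + (x ² + x)      ≡⟨ expand x ⟩
  suc x ² + suc x            ∎
  where
  open ≡-Reasoning
  expand : ∀ x → 2 * suc x + (x * x + x) ≡ suc x * suc x + suc x
  expand = solve-∀

parallelogram-≤ : ∀ {x y} → x ≤ y → (x + y) ² + ∣ x - y ∣ ² ≡ 2 * x ² + 2 * y ²
parallelogram-≤ {x} x≤y with d , refl ← m≤n⇒∃[o]m+o≡n x≤y rewrite ∣m-m+n∣≡n x d = expand x d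
  where
  expand : ∀ x d → (x + (x + d)) * (x + (x + d)) + d * d ≡ 2 * (x * x) + 2 * ((x + d) * (x + d))
  expand = solve-∀

parallelogram : ∀ x y → (x + y) ² + ∣ x - y ∣ ² ≡ 2 * x ² + 2 * y ²
parallelogram x y with ≤-total x y
... | inj₁ x≤y = parallelogram-≤ x≤y
... | inj₂ y≤x rewrite +-comm x y | ∣-∣-comm x y = trans (parallelogram-≤ y≤x) (+-comm (2 * y ²) (2 * x ²))

4*[tri+tri] : ∀ x y → 4 * (tri x + tri y) ≡ ((x + y) ² + 2 * (x + y)) + ∣ x - y ∣ ²
4*[tri+tri] x y = begin
  4 * (tri x + tri y)                       ≡⟨ regroup (tri x) (tri y) ⟩
  2 * (2 * tri x) + 2 * (2 * tri y)          ≡⟨ cong₂ (λ u v → 2 * u + 2 * v) (2*tri≡²+ x) (2*tri≡²+ y) ⟩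
  2 * (x ² + x) + 2 * (y ² + y)              ≡⟨ regroup′ (x ²) x (y ²) y ⟩
  (2 * x ² + 2 * y ²) + 2 * (x + y)          ≡⟨ cong (_+ 2 * (x + y)) (parallelogram x y) ⟨
  ((x + y) ² + ∣ x - y ∣ ²) + 2 * (x + y)    ≡⟨ xy∙z≈xz∙y ((x + y) ²) (∣ x - y ∣ ²) (2 * (x + y)) ⟩
  ((x + y) ² + 2 * (x + y)) + ∣ x - y ∣ ²    ∎
  where
  open ≡-Reasoning
  regroup : ∀ u v → 4 * (u + v) ≡ 2 * (2 * u) + 2 * (2 * v)
  regroup = solve-∀
  regroup′ : ∀ a b c d → 2 * (a + b) + 2 * (c + d) ≡ (2 * a + 2 * c) + 2 * (b + d)
  regroup′ = solve-∀

4*sumF[tri+tri] : ∀ {K} (x y : Fin K → ℕ) →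
                  4 * sumF (λ k → tri (x k) + tri (y k)) ≡
                  sumF (λ k → (x k + y k) ² + 2 * (x k + y k)) + sumF (λ k → ∣ x k - y k ∣ ²)
4*sumF[tri+tri] {K} x y =
  trans (*-distribˡ-sumF {K} 4 _) (trans (sumF-cong (λ k → 4*[tri+tri] (x k) (y k))) (sumF-+ {K} _ _))

sumF-tri-≤⇒sumF-∣-∣²-≤ : ∀ {K} (x y x′ y′ : Fin K → ℕ) → (∀ k → x k + y k ≡ x′ k + y′ k) →
                         sumF (λ k → tri (x k) + tri (y k)) ≤ sumF (λ k → tri (x′ k) + tri (y′ k)) →
                         sumF (λ k → ∣ x k - y k ∣ ²) ≤ sumF (λ k → ∣ x′ k - y′ k ∣ ²)
sumF-tri-≤⇒sumF-∣-∣²-≤ {K} x y x′ y′ same-total tri≤ =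
  +-cancelˡ-≤ (sumF energy) _ _ (subst₂ _≤_ (4*sumF[tri+tri] x y) 4*tri′≡ (*-monoʳ-≤ 4 tri≤))
  where
  energy : Fin K → ℕ
  energy k = (x k + y k) ² + 2 * (x k + y k)
  4*tri′≡ : 4 * sumF (λ k → tri (x′ k) + tri (y′ k)) ≡ sumF energy + sumF (λ k → ∣ x′ k - y′ k ∣ ²)
  4*tri′≡ = trans (4*sumF[tri+tri] x′ y′)
                  (cong (_+ _) (sumF-cong (λ k → cong (λ s → s ² + 2 * s) (sym (same-total k)))))

pairCost : ∀ {n m K} → Scenarios n K → Assignment n m → Fin m → Fin m → ℕ
pairCost S φ a b = sumF (λ k → tri (load S φ k a) + tri (load S φ k b))

Optimal⇒pairCost≤ : ∀ {n m K} {S : Scenarios n K} {φ ψ : Assignment n m} {a b : Fin m} →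
                    Optimal S φ → a ≢ b → (∀ k i → i ≢ a → i ≢ b → load S φ k i ≡ load S ψ k i) →
                    pairCost S φ a b ≤ pairCost S ψ a b
Optimal⇒pairCost≤ {K = K} {S} {φ} {ψ} {a} {b} opt a≢b same = +-cancelˡ-≤ (cost S ψ) _ _ (begin
  cost S ψ + pairCost S φ a b ≡⟨ exchange-costs ⟨
  cost S φ + pairCost S ψ a b ≤⟨ +-monoˡ-≤ _ (opt ψ) ⟩
  cost S ψ + pairCost S ψ a b ∎)
  where
  open ≤-Reasoning
  exchange-costs : cost S φ + pairCost S ψ a b ≡ cost S ψ + pairCost S φ a b
  exchange-costs = begin-equality
    cost S φ + pairCost S ψ a b
      ≡⟨ sumF-+ {K} _ _ ⟨
    sumF (λ k → G S φ k + (tri (load S ψ k a) + tri (load S ψ k b)))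
      ≡⟨ sumF-cong (λ k → sumF-swap₂ a≢b (λ i i≢a i≢b → cong tri (same k i i≢a i≢b))) ⟩
    sumF (λ k → G S ψ k + (tri (load S φ k a) + tri (load S φ k b)))
      ≡⟨ sumF-+ {K} _ _ ⟩
    cost S ψ + pairCost S φ a b ∎

onEither : ∀ {n m} → Assignment n m → Fin m → Fin m → Fin n → Bool
onEither φ a b j = ⌊ φ j ≟ a ⌋ ∨ ⌊ φ j ≟ b ⌋

exchange : ∀ {n m} → Assignment n m → Fin m → Fin m → (Fin n → Bool) → Assignment n m
exchange φ a b c j = if onEither φ a b j then (if c j then a else b) else φ j

module _ {n m} (φ : Assignment n m) {a b : Fin m} (a≢b : a ≢ b) (c : Fin n → Bool) where

  exchange-≟-a : ∀ j → ⌊ exchange φ a b c j ≟ a ⌋ ≡ onEither φ a b j ∧ c j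
  exchange-≟-a j with φ j ≟ a | φ j ≟ b | c j
  ... | yes _   | _     | true  = ⌊x≟x⌋ a
  ... | yes _   | _     | false = ⌊x≟y⌋ (a≢b ∘ sym)
  ... | no _    | yes _ | true  = ⌊x≟x⌋ a
  ... | no _    | yes _ | false = ⌊x≟y⌋ (a≢b ∘ sym)
  ... | no j∉a  | no _  | _     = ⌊x≟y⌋ j∉a

  exchange-≟-b : ∀ j → ⌊ exchange φ a b c j ≟ b ⌋ ≡ onEither φ a b j ∧ not (c j)
  exchange-≟-b j with φ j ≟ a | φ j ≟ b | c j
  ... | yes _   | _     | true  = ⌊x≟y⌋ a≢b
  ... | yes _   | _     | false = ⌊x≟x⌋ b
  ... | no _    | yes _ | true  = ⌊x≟y⌋ a≢b
  ... | no _    | yes _ | false = ⌊x≟x⌋ b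
  ... | no _    | no j∉b | _    = ⌊x≟y⌋ j∉b

  exchange-≟-other : ∀ {i} → i ≢ a → i ≢ b → ∀ j → ⌊ exchange φ a b c j ≟ i ⌋ ≡ ⌊ φ j ≟ i ⌋
  exchange-≟-other i≢a i≢b j with φ j ≟ a | φ j ≟ b | c j
  ... | yes refl | _      | true  = trans (⌊x≟y⌋ (i≢a ∘ sym)) (sym (⌊x≟y⌋ (i≢a ∘ sym)))
  ... | yes refl | _      | false = trans (⌊x≟y⌋ (i≢b ∘ sym)) (sym (⌊x≟y⌋ (i≢a ∘ sym)))
  ... | no _     | yes refl | true  = trans (⌊x≟y⌋ (i≢a ∘ sym)) (sym (⌊x≟y⌋ (i≢b ∘ sym)))
  ... | no _     | yes refl | false = trans (⌊x≟y⌋ (i≢b ∘ sym)) (sym (⌊x≟y⌋ (i≢b ∘ sym)))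
  ... | no _     | no _   | _     = refl

load≡count : ∀ {n m K} (S : Scenarios n K) (φ : Assignment n m) k i →
             load S φ k i ≡ count (λ j → ⌊ φ j ≟ i ⌋ ∧ lookup (S k) j)
load≡count S φ k i = ∣tabulate∩∣≡count _ (S k)

module _ {n m K} (S : Scenarios n K) (φ : Assignment n m) {a b : Fin m} (a≢b : a ≢ b) (c : Fin n → Bool) where

  private
    ψ : Assignment n m
    ψ = exchange φ a b c
    moved : Fin K → Fin n → Bool
    moved k = onEither φ a b ∧̇ lookup (S k)

  load-exchange-a : ∀ k → load S ψ k a ≡ red (moved k) c
  load-exchange-a k = trans (load≡count S ψ k a) (count-cong λ j →
    trans (cong (_∧ lookup (S k) j) (exchange-≟-a φ a≢b c j))
          (xy∧z≡xz∧y (onEither φ a b j) (c j) (lookup (S k) j)))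

  load-exchange-b : ∀ k → load S ψ k b ≡ blue (moved k) c
  load-exchange-b k = trans (load≡count S ψ k b) (count-cong λ j →
    trans (cong (_∧ lookup (S k) j) (exchange-≟-b φ a≢b c j))
          (xy∧z≡xz∧y (onEither φ a b j) (not (c j)) (lookup (S k) j)))

  load-exchange-other : ∀ k i → i ≢ a → i ≢ b → load S φ k i ≡ load S ψ k i
  load-exchange-other k i i≢a i≢b = trans (load≡count S φ k i) (trans
    (count-cong λ j → cong (_∧ lookup (S k) j) (sym (exchange-≟-other φ a≢b c i≢a i≢b j)))
    (sym (load≡count S ψ k i)))

  load-exchange-pair : ∀ k → load S φ k a + load S φ k b ≡ load S ψ k a + load S ψ k b
  load-exchange-pair k = begin
    load S φ k a + load S φ k b      ≡⟨ cong₂ _+_ (load≡count S φ k a) (load≡count S φ k b) ⟩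
    count (λ j → ⌊ φ j ≟ a ⌋ ∧ lookup (S k) j) + count (λ j → ⌊ φ j ≟ b ⌋ ∧ lookup (S k) j)
                                     ≡⟨ count-∨ _ _ (lookup (S k)) disjoint ⟩
    count (moved k)                  ≡⟨ count≡red+blue (moved k) c ⟩
    red (moved k) c + blue (moved k) c ≡⟨ cong₂ _+_ (load-exchange-a k) (load-exchange-b k) ⟨
    load S ψ k a + load S ψ k b      ∎
    where
    open ≡-Reasoning
    disjoint : ∀ j → ⌊ φ j ≟ a ⌋ ∧ ⌊ φ j ≟ b ⌋ ≡ false
    disjoint j with φ j ≟ a | φ j ≟ b
    ... | yes j∈a | yes j∈b = contradiction (trans (sym j∈a) j∈b) a≢b
    ... | yes _   | no _    = refl
    ... | no _    | _       = refl

Optimal⇒sumF-∣-∣²≤ : ∀ {n m K} {S : Scenarios n K} {φ : Assignment n m} → Optimal S φ →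
                     ∀ {a b} → a ≢ b →
                     sumF (λ k → ∣ load S φ k a - load S φ k b ∣ ²) ≤ K * (2 ^ (K ∸ 1)) ²
Optimal⇒sumF-∣-∣²≤ {n} {m} {K} {S} {φ} opt {a} {b} a≢b
  with c , _ , balanced-on ← balancedColouring K (lookup ∘ S) (onEither φ a b) = begin
  sumF (λ k → ∣ load S φ k a - load S φ k b ∣ ²)
    ≤⟨ sumF-tri-≤⇒sumF-∣-∣²-≤ (λ k → load S φ k a) (λ k → load S φ k b)
                               (λ k → load S ψ k a) (λ k → load S ψ k b)
                               (load-exchange-pair S φ a≢b c)
                               (Optimal⇒pairCost≤ opt a≢b (load-exchange-other S φ a≢b c)) ⟩
  sumF (λ k → ∣ load S ψ k a - load S ψ k b ∣ ²)
    ≤⟨ sumF-mono-≤ {K} (λ k → *-mono-≤ (bound k) (bound k)) ⟩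
  sumF {K} (λ _ → (2 ^ (K ∸ 1)) ²)
    ≡⟨ sumF-const K _ ⟩
  K * (2 ^ (K ∸ 1)) ² ∎
  where
  open ≤-Reasoning
  ψ : Assignment n m
  ψ = exchange φ a b c
  bound : ∀ k → ∣ load S ψ k a - load S ψ k b ∣ ≤ 2 ^ (K ∸ 1)
  bound k = subst₂ (λ x y → ∣ x - y ∣ ≤ _)
                   (sym (load-exchange-a S φ a≢b c k)) (sym (load-exchange-b S φ a≢b c k))
                   (Near⇒∣-∣≤ (Balanced.near (balanced-on k)))

maxF-attained : ∀ {m} (f : Fin (suc m) → ℕ) → ∃[ i ] maxF f ≡ f i
maxF-attained {zero}  f = zero , refl
maxF-attained {suc m} f with i , max≡ ← maxF-attained (f ∘ suc) | f zero ≤? f (suc i)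
... | yes f0≤ = suc i , trans (cong (f zero ⊔_) max≡) (m≤n⇒m⊔n≡n f0≤)
... | no f0≰  = zero  , trans (cong (f zero ⊔_) max≡) (m≥n⇒m⊔n≡m (<⇒≤ (≰⇒> f0≰)))

minF-attained : ∀ {m} (f : Fin (suc m) → ℕ) → ∃[ i ] minF f ≡ f i
minF-attained {zero}  f = zero , refl
minF-attained {suc m} f with i , min≡ ← minF-attained (f ∘ suc) | f zero ≤? f (suc i)
... | yes f0≤ = zero  , trans (cong (f zero ⊓_) min≡) (m≤n⇒m⊓n≡m f0≤)
... | no f0≰  = suc i , trans (cong (f zero ⊓_) min≡) (m≥n⇒m⊓n≡n (<⇒≤ (≰⇒> f0≰)))

lemma2 : (n m K : ℕ) (S : Scenarios n K) (φ : Assignment n m) →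
         Optimal S φ → (k : Fin K) →
         disbalance S φ k * disbalance S φ k ≤ K * (2 ^ (K ∸ 1) * 2 ^ (K ∸ 1))
lemma2 n zero    K S φ opt k = z≤n
lemma2 n (suc m) K S φ opt k
  with a , max≡ ← maxF-attained (load S φ k) | b , min≡ ← minF-attained (load S φ k)
  with disbalance≡ ← cong₂ _∸_ max≡ min≡ | a ≟ b
... | yes refl = subst (λ d → d ² ≤ K * (2 ^ (K ∸ 1)) ²) (sym (trans disbalance≡ (n∸n≡0 (load S φ k a)))) z≤n
... | no a≢b   = begin
  disbalance S φ k ²                            ≤⟨ *-mono-≤ d≤ d≤ ⟩
  ∣ load S φ k a - load S φ k b ∣ ²             ≤⟨ f≤sumF (λ k′ → ∣ load S φ k′ a - load S φ k′ b ∣ ²) k ⟩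
  sumF (λ k′ → ∣ load S φ k′ a - load S φ k′ b ∣ ²) ≤⟨ Optimal⇒sumF-∣-∣²≤ {S = S} opt a≢b ⟩
  K * (2 ^ (K ∸ 1)) ²                           ∎
  where
  open ≤-Reasoning
  d≤ : disbalance S φ k ≤ ∣ load S φ k a - load S φ k b ∣
  d≤ = subst (_≤ ∣ load S φ k a - load S φ k b ∣) (sym disbalance≡) (m∸n≤∣m-n∣ (load S φ k a) (load S φ k b))
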